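{- Let $G=(V^+,V^-;E)$ be a bipartite graph with $|V^+|=|V^-|=n\ge2$. Define the family \[\mathcal F=\{(X^+,X^-):\emptyset\ne X^+\subseteq V^+,\ \emptyset\ne X^-\subseteq V^-,\ E\cap(X^+\times X^-)=\emptyset\},\] and, for $(X^+,X^-)\in\mathcal F$, \[g(X^+,X^-)=\max\{0,\ |X^+|+|X^-|-n+1\}.\] Say that an edge set $F\subseteq V^+\times V^-$ covers $g$ if $|F\cap(X^+\times X^-)|\ge g(X^+,X^-)$ for every $(X^+,X^-)\in\mathcal F$. Then an edge set $F\subseteq V^+\times V^-$ covers $g$ if and only if $G+F$ is DM-irreducible.
   Context: A bipartite graph $G=(V^+,V^-;E)$ has finite disjoint vertex sides $V^+,V^-$, and its edge set satisfies $E\subseteq V^+\times V^-$. $G+F$ denotes $(V^+,V^-;E\cup F)$. For $X\subseteq V^+$, $\Gamma_G(X)$ is the set of vertices of $V^-$ adjacent to some vertex of $X$. DM-decomposition. Define $f_G(X)=|\Gamma_G(X)|-|X|$ for $X\subseteq V^+$. Its minimizers form a lattice under union and intersection. Take a maximal chain $X_0\subsetneq\cdots\subsetneq X_k$ of minimizers and set: - $V_0=X_0\cup\Gamma_G(X_0)$; - $V_i=(X_i\setminus X_{i-1})\cup(\Gamma_G(X_i)\setminus\Gamma_G(X_{i-1}))$ for $i=1,\dots,k$; - $V_\infty=(V^+\setminus X_k)\cup(V^-\setminus\Gamma_G(X_k))$. This partition of $V=V^+\cup V^-$ is independent of the chain. $G$ is DM-irreducible if exactly one part is nonempty, i.e.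 $V_0=V$, or $V_1=V$, or $V_\infty=V$. -}

module Defs where

open import Data.Bool using (Bool; true; false; _∨_; _∧_; if_then_else_)
open import Data.Nat using (ℕ; zero; suc; _+_; _∸_; _≤_)
open import Data.Integer as ℤ using (ℤ; +_; _-_)
open import Data.Fin using (Fin; zero; suc; inject₁; fromℕ)
open import Data.Fin.Subset using (Subset; _∈_; _⊆_; _⊂_; _─_; ∁; ⊤; ∣_∣; Nonempty)
open import Data.Vec using (tabulate; lookup)
open import Data.Product using (Σ; ∃; _×_; _,_)
open import Data.Sum using (_⊎_)
open import Data.Empty using (⊥)
open import Relation.Binary.PropositionalEquality using (_≡_)

-- A bipartite graph with |V⁺| = |V⁻| = n: V⁺ = Fin n, V⁻ = Fin n (two tagged
-- copies, hence disjoint); an edge set E ⊆ V⁺ × V⁻ is its characteristic function.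
EdgeSet : ℕ → Set
EdgeSet n = Fin n → Fin n → Bool

_⊕_ : ∀ {n} → EdgeSet n → EdgeSet n → EdgeSet n
(E ⊕ F) u v = E u v ∨ F u v

anyFin : ∀ {n} → (Fin n → Bool) → Bool
anyFin {zero}  p = false
anyFin {suc n} p = p zero ∨ anyFin (λ i → p (suc i))

sumFin : ∀ {n} → (Fin n → ℕ) → ℕ
sumFin {zero}  f = 0
sumFin {suc n} f = f zero + sumFin (λ i → f (suc i))

Γ : ∀ {n} → EdgeSet n → Subset n → Subset n
Γ E X = tabulate (λ v → anyFin (λ u → lookup X u ∧ E u v))

fG : ∀ {n} → EdgeSet n → Subset n → ℤ
fG E X = + ∣ Γ E X ∣ - + ∣ X ∣

Minimizer : ∀ {n} → EdgeSet n → Subset n → Set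
Minimizer E X = ∀ Y → fG E X ℤ.≤ fG E Y

record MaxChain {n} (E : EdgeSet n) : Set where
  field
    k       : ℕ
    X       : Fin (suc k) → Subset n
    minim   : ∀ i → Minimizer E (X i)
    strict  : ∀ (i : Fin k) → X (inject₁ i) ⊂ X (suc i)
    maximal : ∀ Y → Minimizer E Y → (∀ i → Y ⊆ X i ⊎ X i ⊆ Y) → ∃ λ i → Y ≡ X i

-- A part of V = V⁺ ∪ V⁻ is given as a pair (part ∩ V⁺ , part ∩ V⁻).
-- "Part = V" means both components are full.
IsAll : ∀ {n} → Subset n × Subset n → Set
IsAll {n} (A , B) = (A ≡ ⊤) × (B ≡ ⊤)

module _ {n} {E : EdgeSet n} (C : MaxChain E) where
  open MaxChain C

  V₀ : Subset n × Subset n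
  V₀ = X zero , Γ E (X zero)

  V∞ : Subset n × Subset n
  V∞ = ∁ (X (fromℕ k)) , ∁ (Γ E (X (fromℕ k)))

  -- V₁ = V (only meaningful when k ≥ 1)
  V₁IsAll : Set
  V₁IsAll with k | X
  ... | zero  | _ = ⊥
  ... | suc _ | Y = IsAll (Y (suc zero) ─ Y zero , Γ E (Y (suc zero)) ─ Γ E (Y zero))

-- DM-irreducible: exactly one part is nonempty, i.e. V₀ = V, V₁ = V, or V∞ = V
-- (the partition is independent of the chosen maximal chain).
DMIrreducible : ∀ {n} → EdgeSet n → Set
DMIrreducible E = Σ (MaxChain E) λ C → IsAll (V₀ C) ⊎ V₁IsAll C ⊎ IsAll (V∞ C)

InFamily : ∀ {n} → EdgeSet n → Subset n → Subset n → Set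
InFamily E Xp Xm =
  Nonempty Xp × Nonempty Xm × (∀ u v → u ∈ Xp → v ∈ Xm → E u v ≡ false)

-- g(X⁺,X⁻) = max{0, |X⁺|+|X⁻|-n+1}  (truncated subtraction)
g : (n : ℕ) → Subset n → Subset n → ℕ
g n Xp Xm = (∣ Xp ∣ + ∣ Xm ∣ + 1) ∸ n

countBetween : ∀ {n} → EdgeSet n → Subset n → Subset n → ℕ
countBetween F Xp Xm =
  sumFin (λ u → sumFin (λ v →
    if lookup Xp u ∧ lookup Xm v ∧ F u v then 1 else 0))

Covers : ∀ {n} → EdgeSet n → EdgeSet n → Set
Covers {n} E F = ∀ Xp Xm → InFamily E Xp Xm → g n Xp Xm ≤ countBetween F Xp Xm

-- Both conditions are equivalent to G + F being elementary: every nonempty X ⊆ V⁺ with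
-- |Γ(X)| ≤ |X| has Γ(X) = V⁻.
--
-- For an elementary graph Hall's condition holds, so f ≥ 0 = f(∅) = f(V⁺) and ∅, V⁺ are the
-- only minimizers; the maximal chain is ∅ ⊂ V⁺ and V₁ = V.  Conversely V₀ = V makes X₀ = V⁺
-- although ∅ is a minimizer, V∞ = V makes X_k = ∅ although V⁺ is a minimizer, and V₁ = V
-- forces the chain ∅ ⊂ V⁺ with Γ(V⁺) = V⁻, so that any X with f(X) ≤ 0 is ∅ or V⁺.
--
-- If F covers g, a nonempty X with |Γ(X)| ≤ |X| and Γ(X) ≠ V⁻ would give (X, V⁻ ∖ Γ(X)) ∈ 𝓕
-- carrying no edge of F although g(X, V⁻ ∖ Γ(X)) ≥ 1.  Conversely, counting the F-edges of
-- (X⁺, X⁻) ∈ 𝓕 column by column gives at least |Γ(X⁺) ∩ X⁻| ≥ |Γ(X⁺)| + |X⁻| - n, which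
-- suffices when |Γ(X⁺)| > |X⁺|; otherwise X⁺ = V⁺, and as n ≥ 2 every vertex of X⁻ has two
-- neighbours, all joined to it by F.
module Submission where

open import Defs
open import Data.Bool using (Bool; true; false; _∨_; _∧_; if_then_else_)
open import Data.Bool.Properties
  using (∧-zeroʳ; ∨-zeroʳ; ∧-conicalˡ; ∧-conicalʳ; ∨-conicalˡ; ∨-conicalʳ; ¬-not)
open import Data.Nat using (ℕ; zero; suc; _+_; _*_; _∸_; _≤_; _<_; z≤n; s≤s; z<s; _≤?_)
open import Data.Nat.Properties
open import Algebra.Properties.CommutativeSemigroup +-commutativeSemigroup using (interchange)
open import Data.Integer as ℤ using ()
import Data.Integer.Properties as ℤ
open import Data.Fin using (Fin; zero; suc; inject₁; fromℕ)
open import Data.Fin.Relation.Unary.Top using (view; ‵fromℕ; ‵inject₁)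
open import Data.Fin.Subset
  using (Subset; inside; outside; _∈_; _∉_; _⊆_; _⊂_; _⊄_; _∩_; _─_; ∁; ⊤; ⊥; ∣_∣; Nonempty; Empty)
open import Data.Fin.Subset.Properties
open import Data.Vec using ([]; _∷_; tabulate; lookup; here; there)
open import Data.Vec.Properties
  using (lookup∘tabulate; []=⇒lookup; lookup⇒[]=; tabulate-cong; ∷-injectiveʳ)
open import Data.Product using (∃; _×_; _,_; proj₁; proj₂)
open import Data.Sum using (_⊎_; inj₁; inj₂)
open import Data.Empty using (⊥-elim)
open import Function.Base using (_∘_)
open import Function.Bundles using (_⇔_; mk⇔)
open import Relation.Nullary using (yes; no; contradiction)
open import Relation.Binary.PropositionalEquality

-- Finite sums

𝟙 : Bool → ℕ
𝟙 b = if b then 1 else 0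

sumFin-cong : ∀ {n} {f g : Fin n → ℕ} → (∀ i → f i ≡ g i) → sumFin f ≡ sumFin g
sumFin-cong {zero}  eq = refl
sumFin-cong {suc n} eq = cong₂ _+_ (eq zero) (sumFin-cong (eq ∘ suc))

sumFin-0 : ∀ n → sumFin {n} (λ _ → 0) ≡ 0
sumFin-0 zero    = refl
sumFin-0 (suc n) = sumFin-0 n

sumFin-distrib-+ : ∀ {n} (f g : Fin n → ℕ) → sumFin (λ i → f i + g i) ≡ sumFin f + sumFin g
sumFin-distrib-+ {zero}  f g = refl
sumFin-distrib-+ {suc n} f g =
  trans (cong (f zero + g zero +_) (sumFin-distrib-+ (f ∘ suc) (g ∘ suc)))
        (interchange (f zero) (g zero) (sumFin (f ∘ suc)) (sumFin (g ∘ suc)))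

sumFin-comm : ∀ {m n} (f : Fin m → Fin n → ℕ) →
              sumFin (λ i → sumFin (f i)) ≡ sumFin (λ j → sumFin (λ i → f i j))
sumFin-comm {zero}  {n} f = sym (sumFin-0 n)
sumFin-comm {suc m} f = begin
  sumFin (f zero) + sumFin (λ i → sumFin (f (suc i)))
    ≡⟨ cong (sumFin (f zero) +_) (sumFin-comm (f ∘ suc)) ⟩
  sumFin (f zero) + sumFin (λ j → sumFin (λ i → f (suc i) j))
    ≡⟨ sym (sumFin-distrib-+ (f zero) _) ⟩
  sumFin (λ j → sumFin (λ i → f i j)) ∎
  where open ≡-Reasoning

sumOver : ∀ {n} → Subset n → (Fin n → ℕ) → ℕ
sumOver X w = sumFin (λ v → 𝟙 (lookup X v) * w v)

syntax sumOver X (λ v → w) = ∑[ v ∈ X ] w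

sumOver-⊆ : ∀ {n} {X Y : Subset n} (w : Fin n → ℕ) → X ⊆ Y → sumOver X w ≤ sumOver Y w
sumOver-⊆ {X = []}          {[]}          w X⊆Y = z≤n
sumOver-⊆ {X = outside ∷ X} {outside ∷ Y} w X⊆Y = sumOver-⊆ (w ∘ suc) (drop-∷-⊆ X⊆Y)
sumOver-⊆ {X = outside ∷ X} {inside  ∷ Y} w X⊆Y =
  ≤-trans (sumOver-⊆ (w ∘ suc) (drop-∷-⊆ X⊆Y)) (m≤n+m _ _)
sumOver-⊆ {X = inside  ∷ X} {outside ∷ Y} w X⊆Y = contradiction (X⊆Y here) λ ()
sumOver-⊆ {X = inside  ∷ X} {inside  ∷ Y} w X⊆Y = +-monoʳ-≤ _ (sumOver-⊆ (w ∘ suc) (drop-∷-⊆ X⊆Y))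

sumOver-≥ : ∀ {n} (X : Subset n) (w : Fin n → ℕ) {c} → (∀ {v} → v ∈ X → c ≤ w v) →
            c * ∣ X ∣ ≤ sumOver X w
sumOver-≥ []            w {c} c≤w = ≤-reflexive (*-zeroʳ c)
sumOver-≥ (outside ∷ X) w     c≤w = sumOver-≥ X (w ∘ suc) (c≤w ∘ there)
sumOver-≥ (inside  ∷ X) w {c} c≤w = begin
  c * suc ∣ X ∣         ≡⟨ *-suc c ∣ X ∣ ⟩
  c + c * ∣ X ∣         ≤⟨ +-mono-≤ (≤-trans (c≤w here) (m≤m+n _ 0))
                                   (sumOver-≥ X (w ∘ suc) (c≤w ∘ there)) ⟩
  sumOver (inside ∷ X) w ∎
  where open ≤-Reasoning

sumOver-≡0 : ∀ {n} (X : Subset n) (w : Fin n → ℕ) → (∀ {v} → v ∈ X → w v ≡ 0) → sumOver X w ≡ 0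
sumOver-≡0 []            w w≡0 = refl
sumOver-≡0 (outside ∷ X) w w≡0 = sumOver-≡0 X (w ∘ suc) (w≡0 ∘ there)
sumOver-≡0 (inside  ∷ X) w w≡0 =
  cong₂ _+_ (cong (_+ 0) (w≡0 here)) (sumOver-≡0 X (w ∘ suc) (w≡0 ∘ there))

∣p∩tabulate∣ : ∀ {n} (p : Subset n) (f : Fin n → Bool) →
              ∣ p ∩ tabulate f ∣ ≡ sumFin (λ i → 𝟙 (lookup p i ∧ f i))
∣p∩tabulate∣ []      f = refl
∣p∩tabulate∣ (b ∷ p) f with b ∧ f zero
... | true  = cong suc (∣p∩tabulate∣ p (f ∘ suc))
... | false = ∣p∩tabulate∣ p (f ∘ suc)

∣p∣+∣q∣≤n+∣p∩q∣ : ∀ {n} (p q : Subset n) → ∣ p ∣ + ∣ q ∣ ≤ n + ∣ p ∩ q ∣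
∣p∣+∣q∣≤n+∣p∩q∣ []            []            = z≤n
∣p∣+∣q∣≤n+∣p∩q∣ (inside  ∷ p) (inside  ∷ q) =
  s≤s (subst₂ _≤_ (sym (+-suc _ _)) (sym (+-suc _ _)) (s≤s (∣p∣+∣q∣≤n+∣p∩q∣ p q)))
∣p∣+∣q∣≤n+∣p∩q∣ (inside  ∷ p) (outside ∷ q) = s≤s (∣p∣+∣q∣≤n+∣p∩q∣ p q)
∣p∣+∣q∣≤n+∣p∩q∣ {suc n} (outside ∷ p) (inside  ∷ q) =
  subst (_≤ suc (n + ∣ p ∩ q ∣)) (sym (+-suc ∣ p ∣ ∣ q ∣)) (s≤s (∣p∣+∣q∣≤n+∣p∩q∣ p q))
∣p∣+∣q∣≤n+∣p∩q∣ (outside ∷ p) (outside ∷ q) = m≤n⇒m≤1+n (∣p∣+∣q∣≤n+∣p∩q∣ p q)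

∣Empty∣≡0 : ∀ {n} {p : Subset n} → Empty p → ∣ p ∣ ≡ 0
∣Empty∣≡0 {n} p-empty = trans (cong ∣_∣ (Empty-unique p-empty)) (∣⊥∣≡0 n)

0<∣p∣⇒Nonempty : ∀ {n} {p : Subset n} → 0 < ∣ p ∣ → Nonempty p
0<∣p∣⇒Nonempty {p = p} 0<∣p∣ with nonempty? p
... | yes ne = ne
... | no  ¬ne = contradiction (∣Empty∣≡0 ¬ne) (>⇒≢ 0<∣p∣)

Nonempty⇒0<∣p∣ : ∀ {n} {p : Subset n} → Nonempty p → 0 < ∣ p ∣
Nonempty⇒0<∣p∣ {n} {p} (x , x∈p) = subst (_< ∣ p ∣) (∣⊥∣≡0 n) (p⊂q⇒∣p∣<∣q∣ (⊥⊆ , x , x∈p , ∉⊥))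

x∉p⇒∣p∣<n : ∀ {n} {p : Subset n} {x} → x ∉ p → ∣ p ∣ < n
x∉p⇒∣p∣<n {n} {p} {x} x∉p = subst (∣ p ∣ <_) (∣⊤∣≡n n) (p⊂q⇒∣p∣<∣q∣ (⊆⊤ , x , ∈⊤ , x∉p))

Empty∁⇒≡⊤ : ∀ {n} {p : Subset n} → Empty (∁ p) → p ≡ ⊤
Empty∁⇒≡⊤ ∁p-empty = ⊆-antisym ⊆⊤ (λ {x} _ → x∉∁p⇒x∈p (λ x∈∁p → ∁p-empty (x , x∈∁p)))

∁≡⊤⇒≡⊥ : ∀ {n} {p : Subset n} → ∁ p ≡ ⊤ → p ≡ ⊥
∁≡⊤⇒≡⊥ ∁p≡⊤ = Empty-unique (λ (x , x∈p) → x∈p⇒x∉∁p x∈p (subst (x ∈_) (sym ∁p≡⊤) ∈⊤))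

─≡⊤⇒≡⊤×≡⊥ : ∀ {n} (p q : Subset n) → p ─ q ≡ ⊤ → p ≡ ⊤ × q ≡ ⊥
─≡⊤⇒≡⊤×≡⊥ []            []            _   = refl , refl
─≡⊤⇒≡⊤×≡⊥ (inside  ∷ p) (outside ∷ q) p─q≡⊤ =
  let p≡⊤ , q≡⊥ = ─≡⊤⇒≡⊤×≡⊥ p q (∷-injectiveʳ p─q≡⊤) in cong (inside ∷_) p≡⊤ , cong (outside ∷_) q≡⊥
─≡⊤⇒≡⊤×≡⊥ (outside ∷ p) (outside ∷ q) ()
─≡⊤⇒≡⊤×≡⊥ (_       ∷ p) (inside  ∷ q) ()

⊄⊥ : ∀ {n} {p : Subset n} → p ⊄ ⊥
⊄⊥ (_ , _ , x∈⊥ , _) = ∉⊥ x∈⊥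

⊤⊄ : ∀ {n} {p : Subset n} → ⊤ ⊄ p
⊤⊄ (_ , _ , _ , x∉⊤) = x∉⊤ ∈⊤

⊤≢⊥ : ∀ {m} → ⊤ {suc m} ≢ ⊥
⊤≢⊥ ()

∈tabulate⁺ : ∀ {n} {f : Fin n → Bool} {i} → f i ≡ true → i ∈ tabulate f
∈tabulate⁺ {f = f} {i} fi≡true = lookup⇒[]= i _ (trans (lookup∘tabulate f i) fi≡true)

∈tabulate⁻ : ∀ {n} {f : Fin n → Bool} {i} → i ∈ tabulate f → f i ≡ true
∈tabulate⁻ {f = f} {i} i∈ = trans (sym (lookup∘tabulate f i)) ([]=⇒lookup i∈)

anyFin⁺ : ∀ {n} (p : Fin n → Bool) {i} → p i ≡ true → anyFin p ≡ true
anyFin⁺ p {zero}  pi≡true rewrite pi≡true = refl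
anyFin⁺ p {suc i} pi≡true rewrite anyFin⁺ (p ∘ suc) pi≡true = ∨-zeroʳ (p zero)

anyFin⁻ : ∀ {n} (p : Fin n → Bool) → anyFin p ≡ true → ∃ λ i → p i ≡ true
anyFin⁻ {suc n} p any≡true with p zero in p0
... | true  = zero , p0
... | false = let i , pi≡true = anyFin⁻ (p ∘ suc) any≡true in suc i , pi≡true

module _ {n} {H : EdgeSet n} {X : Subset n} where

  ∈Γ⁺ : ∀ {u v} → u ∈ X → H u v ≡ true → v ∈ Γ H X
  ∈Γ⁺ {u} u∈X Huv = ∈tabulate⁺ (anyFin⁺ _ {u} (cong₂ _∧_ ([]=⇒lookup u∈X) Huv))

  ∈Γ⁻ : ∀ {v} → v ∈ Γ H X → ∃ λ u → u ∈ X × H u v ≡ true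
  ∈Γ⁻ v∈ΓX =
    let u , Xu∧Huv = anyFin⁻ _ (∈tabulate⁻ v∈ΓX)
    in u , lookup⇒[]= u X (∧-conicalˡ _ _ Xu∧Huv) , ∧-conicalʳ _ _ Xu∧Huv

Γ-⊥ : ∀ {n} (H : EdgeSet n) → Γ H ⊥ ≡ ⊥
Γ-⊥ H = Empty-unique (λ (v , v∈Γ⊥) → ∉⊥ (proj₁ (proj₂ (∈Γ⁻ {H = H} v∈Γ⊥))))

column : ∀ {n} → EdgeSet n → Fin n → Subset n
column F v = tabulate (λ u → F u v)

countBetween-by-columns : ∀ {n} (F : EdgeSet n) (Xp Xm : Subset n) →
                          countBetween F Xp Xm ≡ ∑[ v ∈ Xm ] ∣ Xp ∩ column F v ∣
countBetween-by-columns {n} F Xp Xm = begin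
  countBetween F Xp Xm
    ≡⟨ sumFin-comm (λ u v → 𝟙 (lookup Xp u ∧ lookup Xm v ∧ F u v)) ⟩
  sumFin (λ v → sumFin (λ u → 𝟙 (lookup Xp u ∧ lookup Xm v ∧ F u v)))
    ≡⟨ sumFin-cong column-sum ⟩
  ∑[ v ∈ Xm ] ∣ Xp ∩ column F v ∣ ∎
  where
  open ≡-Reasoning
  column-sum : ∀ v → sumFin (λ u → 𝟙 (lookup Xp u ∧ lookup Xm v ∧ F u v)) ≡
                     𝟙 (lookup Xm v) * ∣ Xp ∩ column F v ∣
  column-sum v with lookup Xm v
  ... | true  = sym (trans (+-identityʳ _) (∣p∩tabulate∣ Xp (λ u → F u v)))
  ... | false = trans (sumFin-cong (λ u → cong 𝟙 (∧-zeroʳ (lookup Xp u)))) (sumFin-0 n)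

-- The surplus function f and its minimizers

module _ {n} (H : EdgeSet n) where

  ∣Γ∣≤∣X∣⇒fG≤0 : ∀ X → ∣ Γ H X ∣ ≤ ∣ X ∣ → fG H X ℤ.≤ ℤ.0ℤ
  ∣Γ∣≤∣X∣⇒fG≤0 X = ℤ.i≤j⇒i-j≤0 ∘ ℤ.+≤+

  fG≤0⇒∣Γ∣≤∣X∣ : ∀ X → fG H X ℤ.≤ ℤ.0ℤ → ∣ Γ H X ∣ ≤ ∣ X ∣
  fG≤0⇒∣Γ∣≤∣X∣ X = ℤ.drop‿+≤+ ∘ ℤ.i-j≤0⇒i≤j

  ∣X∣≤∣Γ∣⇒0≤fG : ∀ X → ∣ X ∣ ≤ ∣ Γ H X ∣ → ℤ.0ℤ ℤ.≤ fG H X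
  ∣X∣≤∣Γ∣⇒0≤fG X = ℤ.i≤j⇒0≤j-i ∘ ℤ.+≤+

  0≤fG⇒∣X∣≤∣Γ∣ : ∀ X → ℤ.0ℤ ℤ.≤ fG H X → ∣ X ∣ ≤ ∣ Γ H X ∣
  0≤fG⇒∣X∣≤∣Γ∣ X = ℤ.drop‿+≤+ ∘ ℤ.0≤i-j⇒j≤i

  fG-⊥ : fG H ⊥ ≡ ℤ.0ℤ
  fG-⊥ rewrite Γ-⊥ H | ∣⊥∣≡0 n = refl

  minimizer⇒∣Γ∣≤∣X∣ : ∀ X → Minimizer H X → ∣ Γ H X ∣ ≤ ∣ X ∣
  minimizer⇒∣Γ∣≤∣X∣ X X-min = fG≤0⇒∣Γ∣≤∣X∣ X (ℤ.≤-trans (X-min ⊥) (ℤ.≤-reflexive fG-⊥))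

  minimizer⇒hall : ∀ X → Minimizer H X → ∣ X ∣ ≤ ∣ Γ H X ∣ → ∀ Y → ∣ Y ∣ ≤ ∣ Γ H Y ∣
  minimizer⇒hall X X-min ∣X∣≤∣ΓX∣ Y = 0≤fG⇒∣X∣≤∣Γ∣ Y (ℤ.≤-trans (∣X∣≤∣Γ∣⇒0≤fG X ∣X∣≤∣ΓX∣) (X-min Y))

  hall⇒⊥-minimizer : (∀ Y → ∣ Y ∣ ≤ ∣ Γ H Y ∣) → Minimizer H ⊥
  hall⇒⊥-minimizer hall Y = subst (ℤ._≤ fG H Y) (sym fG-⊥) (∣X∣≤∣Γ∣⇒0≤fG Y (hall Y))

  ∣Γ∣≤∣X∣⇒minimizer : Minimizer H ⊥ → ∀ X → ∣ Γ H X ∣ ≤ ∣ X ∣ → Minimizer H X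
  ∣Γ∣≤∣X∣⇒minimizer ⊥-min X ∣ΓX∣≤∣X∣ Y =
    ℤ.≤-trans (∣Γ∣≤∣X∣⇒fG≤0 X ∣ΓX∣≤∣X∣) (subst (ℤ._≤ fG H Y) fG-⊥ (⊥-min Y))

  ⊥-minimizer⇒⊤-minimizer : Minimizer H ⊥ → Minimizer H ⊤
  ⊥-minimizer⇒⊤-minimizer ⊥-min = ∣Γ∣≤∣X∣⇒minimizer ⊥-min ⊤ (p⊆q⇒∣p∣≤∣q∣ {p = Γ H ⊤} ⊆⊤)

module _ {n} {H : EdgeSet n} (C : MaxChain H) where
  open MaxChain C

  bottom≡⊥ : Minimizer H ⊥ → X zero ≡ ⊥
  bottom≡⊥ ⊥-min with maximal ⊥ ⊥-min (λ _ → inj₁ ⊥⊆)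
  ... | zero  , ⊥≡X₀  = sym ⊥≡X₀
  ... | suc i , ⊥≡Xᵢ₊₁ = ⊥-elim (⊄⊥ (subst (X (inject₁ i) ⊂_) (sym ⊥≡Xᵢ₊₁) (strict i)))

  top≡⊤ : Minimizer H ⊤ → X (fromℕ k) ≡ ⊤
  top≡⊤ ⊤-min with maximal ⊤ ⊤-min (λ _ → inj₂ ⊆⊤)
  ... | i , ⊤≡Xᵢ with view i
  ...   | ‵fromℕ     = sym ⊤≡Xᵢ
  ...   | ‵inject₁ j = ⊥-elim (⊤⊄ (subst (_⊂ X (suc j)) (sym ⊤≡Xᵢ) (strict j)))

-- Elementary graphs

-- For n ≥ 1 this says that H has a perfect matching and |Γ(X)| > |X| for every nonempty
-- proper X ⊆ V⁺ (the elementary bipartite graphs of matching theory).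
Elementary : ∀ {n} → EdgeSet n → Set
Elementary H = ∀ X → Nonempty X → ∣ Γ H X ∣ ≤ ∣ X ∣ → Γ H X ≡ ⊤

module _ {n} (H : EdgeSet n) (el : Elementary H) where

  ∣Γ∣≤∣X∣⇒≡⊤ : ∀ {X} → Nonempty X → ∣ Γ H X ∣ ≤ ∣ X ∣ → X ≡ ⊤
  ∣Γ∣≤∣X∣⇒≡⊤ {X} ne ∣ΓX∣≤∣X∣ = ∣p∣≡n⇒p≡⊤ (≤-antisym (∣p∣≤n X) (begin
    n         ≡⟨ sym (∣⊤∣≡n n) ⟩
    ∣ ⊤ {n} ∣ ≡⟨ cong ∣_∣ (sym (el X ne ∣ΓX∣≤∣X∣)) ⟩
    ∣ Γ H X ∣ ≤⟨ ∣ΓX∣≤∣X∣ ⟩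
    ∣ X ∣     ∎))
    where open ≤-Reasoning

  elementary⇒hall : ∀ X → ∣ X ∣ ≤ ∣ Γ H X ∣
  elementary⇒hall X with nonempty? X
  ... | no  ¬ne = subst (_≤ ∣ Γ H X ∣) (sym (∣Empty∣≡0 ¬ne)) z≤n
  ... | yes ne with ∣ Γ H X ∣ ≤? ∣ X ∣
  ...   | no  ∣ΓX∣≰∣X∣ = <⇒≤ (≰⇒> ∣ΓX∣≰∣X∣)
  ...   | yes ∣ΓX∣≤∣X∣ rewrite el X ne ∣ΓX∣≤∣X∣ = p⊆q⇒∣p∣≤∣q∣ {p = X} ⊆⊤

  -- If v had at most one neighbour, its non-neighbours Z would form a nonempty set
  -- with |Γ(Z)| ≤ n - 1 ≤ |Z|, yet v ∉ Γ(Z).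
  elementary⇒2≤∣column∣ : 2 ≤ n → ∀ v → 2 ≤ ∣ column H v ∣
  elementary⇒2≤∣column∣ 2≤n v with 2 ≤? ∣ column H v ∣
  ... | yes 2≤d = 2≤d
  ... | no  2≰d = contradiction (subst (v ∈_) (sym ΓZ≡⊤) ∈⊤) v∉ΓZ
    where
    d : ℕ
    d = ∣ column H v ∣
    Z : Subset n
    Z = ∁ (column H v)
    v∉ΓZ : v ∉ Γ H Z
    v∉ΓZ v∈ΓZ = let u , u∈Z , Huv = ∈Γ⁻ v∈ΓZ in x∈∁p⇒x∉p u∈Z (∈tabulate⁺ Huv)
    ∣ΓZ∣≤∣Z∣ : ∣ Γ H Z ∣ ≤ ∣ Z ∣
    ∣ΓZ∣≤∣Z∣ = subst (∣ Γ H Z ∣ ≤_) (sym (∣∁p∣≡n∸∣p∣ (column H v))) (m+n≤o⇒m≤o∸n ∣ Γ H Z ∣ (begin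
      ∣ Γ H Z ∣ + d ≤⟨ +-monoʳ-≤ _ (≤-pred (≰⇒> 2≰d)) ⟩
      ∣ Γ H Z ∣ + 1 ≡⟨ +-comm _ 1 ⟩
      suc ∣ Γ H Z ∣ ≤⟨ x∉p⇒∣p∣<n v∉ΓZ ⟩
      n             ∎))
      where open ≤-Reasoning
    0<∣Z∣ : 0 < ∣ Z ∣
    0<∣Z∣ = subst (0 <_) (sym (∣∁p∣≡n∸∣p∣ (column H v))) (m<n⇒0<n∸m (<-≤-trans (≰⇒> 2≰d) 2≤n))
    ΓZ≡⊤ : Γ H Z ≡ ⊤
    ΓZ≡⊤ = el Z (0<∣p∣⇒Nonempty 0<∣Z∣) ∣ΓZ∣≤∣Z∣

module _ {m} {H : EdgeSet (suc m)} where

  elementary⇒dmIrreducible : Elementary H → DMIrreducible H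
  elementary⇒dmIrreducible el = chain , inj₂ (inj₁ (p─⊥≡p ⊤ , ΓX₁─ΓX₀≡⊤))
    where
    ⊥-min : Minimizer H ⊥
    ⊥-min = hall⇒⊥-minimizer H (elementary⇒hall H el)
    X : Fin 2 → Subset (suc m)
    X zero       = ⊥
    X (suc zero) = ⊤
    minim : ∀ i → Minimizer H (X i)
    minim zero       = ⊥-min
    minim (suc zero) = ⊥-minimizer⇒⊤-minimizer H ⊥-min
    maximal : ∀ Y → Minimizer H Y → (∀ i → Y ⊆ X i ⊎ X i ⊆ Y) → ∃ λ i → Y ≡ X i
    maximal Y Y-min _ with nonempty? Y
    ... | no  ¬ne = zero , Empty-unique ¬ne
    ... | yes ne  = suc zero , ∣Γ∣≤∣X∣⇒≡⊤ H el ne (minimizer⇒∣Γ∣≤∣X∣ H Y Y-min)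
    chain : MaxChain H
    chain = record
      { k       = 1
      ; X       = X
      ; minim   = minim
      ; strict  = λ { zero → ⊆⊤ , zero , ∈⊤ , ∉⊥ }
      ; maximal = maximal
      }
    ΓX₁─ΓX₀≡⊤ : Γ H ⊤ ─ Γ H ⊥ ≡ ⊤
    ΓX₁─ΓX₀≡⊤ = begin
      Γ H ⊤ ─ Γ H ⊥ ≡⟨ cong (Γ H ⊤ ─_) (Γ-⊥ H) ⟩
      Γ H ⊤ ─ ⊥     ≡⟨ p─⊥≡p (Γ H ⊤) ⟩
      Γ H ⊤         ≡⟨ el ⊤ (zero , ∈⊤) (p⊆q⇒∣p∣≤∣q∣ {p = Γ H ⊤} ⊆⊤) ⟩
      ⊤             ∎
      where open ≡-Reasoning

  V₁≡V⇒elementary : (C : MaxChain H) → V₁IsAll C → Elementary H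
  V₁≡V⇒elementary record { k = zero } ()
  V₁≡V⇒elementary record { k = suc (suc _) ; X = X ; strict = strict } (X₁─X₀≡⊤ , _) =
    ⊥-elim (⊤⊄ (subst (_⊂ X (suc (suc zero))) (proj₁ (─≡⊤⇒≡⊤×≡⊥ _ _ X₁─X₀≡⊤)) (strict (suc zero))))
  V₁≡V⇒elementary record { k = 1 ; X = X ; minim = minim ; maximal = maximal }
                  (X₁─X₀≡⊤ , ΓX₁─ΓX₀≡⊤) Y (y , y∈Y) ∣ΓY∣≤∣Y∣ =
    ΓX≡⊤ (maximal Y Y-min comparable)
    where
    X₁≡⊤ : X (suc zero) ≡ ⊤
    X₁≡⊤ = proj₁ (─≡⊤⇒≡⊤×≡⊥ _ _ X₁─X₀≡⊤)
    X₀≡⊥ : X zero ≡ ⊥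
    X₀≡⊥ = proj₂ (─≡⊤⇒≡⊤×≡⊥ _ _ X₁─X₀≡⊤)
    Y-min : Minimizer H Y
    Y-min = ∣Γ∣≤∣X∣⇒minimizer H (subst (Minimizer H) X₀≡⊥ (minim zero)) Y ∣ΓY∣≤∣Y∣
    comparable : ∀ i → Y ⊆ X i ⊎ X i ⊆ Y
    comparable zero       = inj₂ (subst (_⊆ Y) (sym X₀≡⊥) ⊥⊆)
    comparable (suc zero) = inj₁ (subst (Y ⊆_) (sym X₁≡⊤) ⊆⊤)
    ΓX≡⊤ : (∃ λ i → Y ≡ X i) → Γ H Y ≡ ⊤
    ΓX≡⊤ (zero     , Y≡X₀) = ⊥-elim (∉⊥ (subst (y ∈_) (trans Y≡X₀ X₀≡⊥) y∈Y))
    ΓX≡⊤ (suc zero , Y≡X₁) = trans (cong (Γ H) Y≡X₁) (proj₁ (─≡⊤⇒≡⊤×≡⊥ _ _ ΓX₁─ΓX₀≡⊤))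

  dmIrreducible⇒elementary : DMIrreducible H → Elementary H
  dmIrreducible⇒elementary (C , inj₁ (X₀≡⊤ , ΓX₀≡⊤)) =
    ⊥-elim (⊤≢⊥ (trans (sym X₀≡⊤) (bottom≡⊥ C ⊥-min)))
    where
    open MaxChain C
    ⊥-min : Minimizer H ⊥
    ⊥-min = hall⇒⊥-minimizer H
      (minimizer⇒hall H (X zero) (minim zero) (≤-reflexive (cong ∣_∣ (trans X₀≡⊤ (sym ΓX₀≡⊤)))))
  dmIrreducible⇒elementary (C , inj₂ (inj₁ V₁≡V)) = V₁≡V⇒elementary C V₁≡V
  dmIrreducible⇒elementary (C , inj₂ (inj₂ (∁Xₖ≡⊤ , _))) =
    ⊥-elim (⊤≢⊥ (trans (sym (top≡⊤ C ⊤-min)) Xₖ≡⊥))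
    where
    open MaxChain C
    Xₖ≡⊥ : X (fromℕ k) ≡ ⊥
    Xₖ≡⊥ = ∁≡⊤⇒≡⊥ ∁Xₖ≡⊤
    ⊤-min : Minimizer H ⊤
    ⊤-min = ⊥-minimizer⇒⊤-minimizer H (subst (Minimizer H) Xₖ≡⊥ (minim (fromℕ k)))

covers⇒elementary : ∀ {n} (E F : EdgeSet n) → Covers E F → Elementary (E ⊕ F)
covers⇒elementary {n} E F covers X ne ∣ΓX∣≤∣X∣ with nonempty? (∁ (Γ (E ⊕ F) X))
... | no  ¬ne∁ = Empty∁⇒≡⊤ ¬ne∁
... | yes ne∁  = contradiction (≤-trans 0<g (subst (g n X Y ≤_) count≡0 (covers X Y family))) λ ()
  where
  ΓX Y : Subset n
  ΓX = Γ (E ⊕ F) X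
  Y  = ∁ ΓX
  no-edge : ∀ u v → u ∈ X → v ∈ Y → (E ⊕ F) u v ≡ false
  no-edge u v u∈X v∈Y = ¬-not (λ Huv → x∈∁p⇒x∉p v∈Y (∈Γ⁺ u∈X Huv))
  family : InFamily E X Y
  family = ne , ne∁ , λ u v u∈X v∈Y → ∨-conicalˡ _ _ (no-edge u v u∈X v∈Y)
  no-F-edge-into : ∀ {v} → v ∈ Y → Empty (X ∩ column F v)
  no-F-edge-into {v} v∈Y (u , u∈) =
    let u∈X , u∈column = x∈p∩q⁻ X _ u∈
    in contradiction (trans (sym (∈tabulate⁻ u∈column)) (∨-conicalʳ _ _ (no-edge u v u∈X v∈Y))) λ ()
  count≡0 : countBetween F X Y ≡ 0
  count≡0 = trans (countBetween-by-columns F X Y)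
                  (sumOver-≡0 Y _ (λ v∈Y → ∣Empty∣≡0 (no-F-edge-into v∈Y)))
  0<g : 0 < g n X Y
  0<g = m<n⇒0<n∸m (begin-strict
    n                       ≡⟨ sym (m+[n∸m]≡n (∣p∣≤n ΓX)) ⟩
    ∣ ΓX ∣ + (n ∸ ∣ ΓX ∣)   ≡⟨ cong (∣ ΓX ∣ +_) (sym (∣∁p∣≡n∸∣p∣ ΓX)) ⟩
    ∣ ΓX ∣ + ∣ Y ∣          ≤⟨ +-monoˡ-≤ ∣ Y ∣ ∣ΓX∣≤∣X∣ ⟩
    ∣ X ∣ + ∣ Y ∣           <⟨ m<m+n _ z<s ⟩
    ∣ X ∣ + ∣ Y ∣ + 1       ∎)
    where open ≤-Reasoning

module _ {n} {E : EdgeSet n} (F : EdgeSet n) {Xp Xm : Subset n} (family : InFamily E Xp Xm) where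

  private
    no-E-edge : ∀ u v → u ∈ Xp → v ∈ Xm → E u v ≡ false
    no-E-edge = proj₂ (proj₂ family)

  ⊕-edge⇒F-edge : ∀ {u v} → u ∈ Xp → v ∈ Xm → (E ⊕ F) u v ≡ true → F u v ≡ true
  ⊕-edge⇒F-edge {u} {v} u∈Xp v∈Xm = subst (λ b → b ∨ F u v ≡ true) (no-E-edge u v u∈Xp v∈Xm)

  ∣Γ∩Xm∣≤countBetween : ∣ Γ (E ⊕ F) Xp ∩ Xm ∣ ≤ countBetween F Xp Xm
  ∣Γ∩Xm∣≤countBetween = begin
    ∣ Γ (E ⊕ F) Xp ∩ Xm ∣                          ≡⟨ sym (*-identityˡ _) ⟩
    1 * ∣ Γ (E ⊕ F) Xp ∩ Xm ∣                      ≤⟨ sumOver-≥ (Γ (E ⊕ F) Xp ∩ Xm) _ F-edge-into ⟩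
    ∑[ v ∈ Γ (E ⊕ F) Xp ∩ Xm ] ∣ Xp ∩ column F v ∣ ≤⟨ sumOver-⊆ _ (p∩q⊆q (Γ (E ⊕ F) Xp) Xm) ⟩
    ∑[ v ∈ Xm ] ∣ Xp ∩ column F v ∣                ≡⟨ sym (countBetween-by-columns F Xp Xm) ⟩
    countBetween F Xp Xm                           ∎
    where
    open ≤-Reasoning
    F-edge-into : ∀ {v} → v ∈ Γ (E ⊕ F) Xp ∩ Xm → 1 ≤ ∣ Xp ∩ column F v ∣
    F-edge-into v∈ =
      let v∈Γ , v∈Xm = x∈p∩q⁻ _ _ v∈
          u , u∈Xp , Huv = ∈Γ⁻ v∈Γ
      in Nonempty⇒0<∣p∣ (u , x∈p∩q⁺ (u∈Xp , ∈tabulate⁺ (⊕-edge⇒F-edge u∈Xp v∈Xm Huv)))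

  g≤countBetween-of-surplus : ∣ Xp ∣ < ∣ Γ (E ⊕ F) Xp ∣ → g n Xp Xm ≤ countBetween F Xp Xm
  g≤countBetween-of-surplus surplus = m≤n+o⇒m∸n≤o _ n (begin
    ∣ Xp ∣ + ∣ Xm ∣ + 1            ≡⟨ +-comm _ 1 ⟩
    suc ∣ Xp ∣ + ∣ Xm ∣            ≤⟨ +-monoˡ-≤ ∣ Xm ∣ surplus ⟩
    ∣ Γ (E ⊕ F) Xp ∣ + ∣ Xm ∣      ≤⟨ ∣p∣+∣q∣≤n+∣p∩q∣ (Γ (E ⊕ F) Xp) Xm ⟩
    n + ∣ Γ (E ⊕ F) Xp ∩ Xm ∣      ≤⟨ +-monoʳ-≤ n ∣Γ∩Xm∣≤countBetween ⟩
    n + countBetween F Xp Xm       ∎)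
    where open ≤-Reasoning

module _ {n} {E : EdgeSet n} (F : EdgeSet n) {Xm : Subset n} (family : InFamily E ⊤ Xm) where

  private
    Xm-nonempty : Nonempty Xm
    Xm-nonempty = proj₁ (proj₂ family)
    no-E-edge : ∀ u v → u ∈ ⊤ → v ∈ Xm → E u v ≡ false
    no-E-edge = proj₂ (proj₂ family)

  g≤countBetween-of-⊤ : 2 ≤ n → Elementary (E ⊕ F) → g n ⊤ Xm ≤ countBetween F ⊤ Xm
  g≤countBetween-of-⊤ 2≤n el = m≤n+o⇒m∸n≤o _ n (begin
    ∣ ⊤ {n} ∣ + ∣ Xm ∣ + 1           ≡⟨ cong (λ t → t + ∣ Xm ∣ + 1) (∣⊤∣≡n n) ⟩
    n + ∣ Xm ∣ + 1                   ≡⟨ +-assoc n ∣ Xm ∣ 1 ⟩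
    n + (∣ Xm ∣ + 1)                 ≤⟨ +-monoʳ-≤ n (+-monoʳ-≤ ∣ Xm ∣ (Nonempty⇒0<∣p∣ Xm-nonempty)) ⟩
    n + (∣ Xm ∣ + ∣ Xm ∣)            ≡⟨ cong (λ t → n + (∣ Xm ∣ + t)) (sym (+-identityʳ ∣ Xm ∣)) ⟩
    n + 2 * ∣ Xm ∣                   ≤⟨ +-monoʳ-≤ n (sumOver-≥ Xm _ two-F-edges) ⟩
    n + ∑[ v ∈ Xm ] ∣ ⊤ ∩ column F v ∣ ≡⟨ cong (n +_) (sym (countBetween-by-columns F ⊤ Xm)) ⟩
    n + countBetween F ⊤ Xm          ∎)
    where
    open ≤-Reasoning
    two-F-edges : ∀ {v} → v ∈ Xm → 2 ≤ ∣ ⊤ ∩ column F v ∣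
    two-F-edges {v} v∈Xm =
      subst (λ c → 2 ≤ ∣ c ∣) column-⊕≡⊤∩column (elementary⇒2≤∣column∣ (E ⊕ F) el 2≤n v)
      where
      column-⊕≡⊤∩column : column (E ⊕ F) v ≡ ⊤ ∩ column F v
      column-⊕≡⊤∩column = trans
        (tabulate-cong λ u → cong (_∨ F u v) (no-E-edge u v ∈⊤ v∈Xm))
        (sym (∩-identityˡ (column F v)))

elementary⇒covers : ∀ {n} (E F : EdgeSet n) → 2 ≤ n → Elementary (E ⊕ F) → Covers E F
elementary⇒covers {n} E F 2≤n el Xp Xm family with ∣ Γ (E ⊕ F) Xp ∣ ≤? ∣ Xp ∣
... | no  ∣ΓXp∣≰∣Xp∣ = g≤countBetween-of-surplus F family (≰⇒> ∣ΓXp∣≰∣Xp∣)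
... | yes ∣ΓXp∣≤∣Xp∣ with ∣Γ∣≤∣X∣⇒≡⊤ (E ⊕ F) el (proj₁ family) ∣ΓXp∣≤∣Xp∣
...   | refl = g≤countBetween-of-⊤ F family 2≤n el

claim3p4 : (n : ℕ) → 2 ≤ n → (E F : EdgeSet n) →
    Covers E F ⇔ DMIrreducible (E ⊕ F)
claim3p4 zero    ()
claim3p4 (suc m) 2≤n E F = mk⇔
  (elementary⇒dmIrreducible ∘ covers⇒elementary E F)
  (elementary⇒covers E F 2≤n ∘ dmIrreducible⇒elementary)
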